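{- Let $\Psi=(\Sigma,\mathit{ind})$ be a concurrent alphabet with a total order $\le$ on $\Sigma$, and let $w,u$ be step sequences over $\Psi$. Then $w\equiv^{\mathbb{S}}_\Psi u$ if and only if $lex(w)\equiv^{\Sigma}_\Psi lex(u)$.
   Context: A concurrent alphabet is $\Psi=(\Sigma,\mathit{ind})$ with $\Sigma$ finite nonempty and $\mathit{ind}\subseteq\Sigma\times\Sigma$ irreflexive and symmetric. $\equiv^{\Sigma}_\Psi$ on $\Sigma^*$ is the reflexive transitive closure of $uabz\sim ubaz$ for $(a,b)\in\mathit{ind}$. Steps over $\Psi$: nonempty $A\subseteq\Sigma$ whose distinct elements are pairwise in $\mathit{ind}$; step sequences are finite sequences of steps. $\equiv^{\mathbb{S}}_\Psi$ is the reflexive, symmetric, transitive closure of $uABz\sim u(A\cup B)z$ for steps $A,B$ with $A\times B\subseteq\mathit{ind}$. For a step $A$, $lex(A)$ is the word listing the elements of $A$ in increasing $\le$-order, and $lex(A_1\ldots A_n)=lex(A_1)\cdots lex(A_n)$. -}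

module Defs where

open import Data.Nat using (ℕ; zero; suc; _<_)
open import Data.Fin using (Fin; zero; suc)
open import Data.Fin.Subset using (Subset; Nonempty; _∈_; _∪_)
open import Data.Vec using ([]; _∷_)
open import Data.Bool using (true; false)
open import Data.List using (List; []; _∷_; _++_; map; concatMap)
open import Data.List.Relation.Unary.All using (All)
open import Data.Sum using (inj₁; inj₂)
open import Relation.Binary using (Rel; Irreflexive; Symmetric; IsTotalOrder)
open import Relation.Binary.PropositionalEquality using (_≡_)
open import Relation.Binary.Construct.Closure.ReflexiveTransitive using (Star)
open import Relation.Binary.Construct.Closure.Symmetric using (SymClosure)
open import Level using (0ℓ)

-- A concurrent alphabet Ψ = (Σ, ind).  The finite nonempty alphabet Σ is
-- represented (up to renaming) as Fin n with 0 < n.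
record ConcurrentAlphabet : Set₁ where
  field
    n        : ℕ
    nonempty : 0 < n
    ind      : Rel (Fin n) 0ℓ
    ind-irr  : Irreflexive _≡_ ind
    ind-sym  : Symmetric ind

module _ (Ψ : ConcurrentAlphabet) where
  open ConcurrentAlphabet Ψ

  Σ : Set
  Σ = Fin n

  IsStep : Subset n → Set
  IsStep A = Nonempty A × (∀ {a b} → a ∈ A → b ∈ A → ¬ (a ≡ b) → ind a b)
    where open import Data.Product using (_×_)
          open import Relation.Nullary using (¬_)

  IsStepSeq : List (Subset n) → Set
  IsStepSeq = All IsStep

  data SwapStep : Rel (List Σ) 0ℓ where
    swap : ∀ u a b z → ind a b → SwapStep (u ++ a ∷ b ∷ z) (u ++ b ∷ a ∷ z)

  _≡Σ_ : Rel (List Σ) 0ℓ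
  _≡Σ_ = Star SwapStep

  data MergeStep : Rel (List (Subset n)) 0ℓ where
    merge : ∀ u A B z → IsStep A → IsStep B →
            (∀ {a b} → a ∈ A → b ∈ B → ind a b) →
            MergeStep (u ++ A ∷ B ∷ z) (u ++ (A ∪ B) ∷ z)

  _≡S_ : Rel (List (Subset n)) 0ℓ
  _≡S_ = Star (SymClosure MergeStep)

elems : ∀ {n} → Subset n → List (Fin n)
elems {zero}  []          = []
elems {suc n} (true ∷ p)  = zero ∷ map suc (elems p)
elems {suc n} (false ∷ p) = map suc (elems p)

module _ {n : ℕ} {_≤_ : Rel (Fin n) 0ℓ} (tot : IsTotalOrder _≡_ _≤_) where
  open IsTotalOrder tot using (total)

  insert : Fin n → List (Fin n) → List (Fin n)
  insert x []       = x ∷ []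
  insert x (y ∷ ys) with total x y
  ... | inj₁ _ = x ∷ y ∷ ys
  ... | inj₂ _ = y ∷ insert x ys

  sortList : List (Fin n) → List (Fin n)
  sortList []       = []
  sortList (x ∷ xs) = insert x (sortList xs)

  lexStep : Subset n → List (Fin n)
  lexStep A = sortList (elems A)

  lex : List (Subset n) → List (Fin n)
  lex = concatMap lexStep

module Submission where

-- The letters of a step are pairwise independent, so a step A is equivalent
-- to the sequence of singleton steps of lex(A) (merge them one by one), and
-- hence every step sequence w is ≡S-equivalent to the singletons of lex(w).
-- Forward: merging independent steps A, B turns lex(A) lex(B) into lex(A ∪ B),
-- a permutation of a pairwise independent word, i.e. a chain of swaps.
-- Backward: a swap a b ↦ b a of singleton steps is the merge
-- ⁅a⁆ ⁅b⁆ ↦ ⁅a⁆ ∪ ⁅b⁆ = ⁅b⁆ ∪ ⁅a⁆ followed by the inverse merge into ⁅b⁆ ⁅a⁆.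

open import Defs
open import Data.Bool using (true; false)
open import Data.Empty using (⊥; ⊥-elim)
open import Data.Fin using (Fin; zero; suc)
open import Data.Fin.Properties using (suc-injective)
open import Data.Fin.Subset using (Subset; ⁅_⁆; _∪_) renaming (_∈_ to _∈ₛ_)
open import Data.Fin.Subset.Properties using (x∈⁅x⁆; x∈⁅y⁆⇒x≡y; x∈p∪q⁻; x∈p∪q⁺; ⊆-antisym; ∪-comm)
open import Data.List using (List; []; _∷_; _++_; map)
open import Data.List.Properties using (map-++; concatMap-++; ++-assoc)
open import Data.List.Membership.Propositional using () renaming (_∈_ to _∈ₗ_)
open import Data.List.Membership.Propositional.Properties using (∈-map⁺)
open import Data.List.Relation.Binary.Permutation.Propositional
  using (_↭_; refl; prep; swap; trans; ↭-sym; ↭-reflexive; ↭⇒↭ₛ; module PermutationReasoning)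
open import Data.List.Relation.Binary.Permutation.Propositional.Properties
  using (∈-resp-↭; shift; ++⁺) renaming (map⁺ to ↭-map⁺)
import Data.List.Relation.Binary.Permutation.Setoid.Properties as SetoidPermutation
open import Data.List.Relation.Unary.All as All using (All; []; _∷_)
open import Data.List.Relation.Unary.All.Properties using () renaming (map⁺ to All-map⁺)
open import Data.List.Relation.Unary.AllPairs using (AllPairs; []; _∷_)
open import Data.List.Relation.Unary.AllPairs.Properties using () renaming (map⁺ to AllPairs-map⁺)
open import Data.List.Relation.Unary.Any using (here; there)
open import Data.Nat using (ℕ)
open import Data.Product using (_×_; _,_)
open import Data.Sum using (inj₁; inj₂)
open import Data.Vec using ([]; _∷_; here; there)
open import Function using (_∘_; id)
open import Level using (0ℓ)
open import Relation.Binary using (Rel; Symmetric; IsTotalOrder; _Respects_)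
open import Relation.Binary.Construct.Closure.ReflexiveTransitive
  using (ε; _◅_; _◅◅_; gmap; kleisliStar)
import Relation.Binary.Construct.Closure.ReflexiveTransitive as Star
open import Relation.Binary.Construct.Closure.Symmetric using (SymClosure; fwd; bwd)
import Relation.Binary.Construct.Closure.Symmetric as SymClosure
open import Relation.Binary.PropositionalEquality
  using (_≡_; refl; sym; subst; subst₂; resp₂; setoid)
  renaming (trans to ≡-trans)
open import Relation.Nullary using (¬_)

AllPairs-resp-↭ : ∀ {A : Set} {R : Rel A 0ℓ} → Symmetric R → AllPairs R Respects _↭_
AllPairs-resp-↭ {A} {R} R-sym p =
  SetoidPermutation.AllPairs-resp-↭ (setoid A) R-sym (resp₂ R) (↭⇒↭ₛ p)

elems-All : ∀ {m} {P : Fin m → Set} (A : Subset m) → (∀ {a} → a ∈ₛ A → P a) → All P (elems A)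
elems-All []          h = []
elems-All (true ∷ p)  h = h here ∷ All-map⁺ (elems-All p (h ∘ there))
elems-All (false ∷ p) h = All-map⁺ (elems-All p (h ∘ there))

∈-elems⁻ : ∀ {m} (A : Subset m) {a} → a ∈ₗ elems A → a ∈ₛ A
∈-elems⁻ A = All.lookup (elems-All A id)

∈-elems⁺ : ∀ {m} (A : Subset m) {a} → a ∈ₛ A → a ∈ₗ elems A
∈-elems⁺ (true ∷ p)  here       = here refl
∈-elems⁺ (true ∷ p)  (there a∈) = there (∈-map⁺ suc (∈-elems⁺ p a∈))
∈-elems⁺ (false ∷ p) (there a∈) = ∈-map⁺ suc (∈-elems⁺ p a∈)

elems-AllPairs : ∀ {m} {R : Rel (Fin m) 0ℓ} (A : Subset m) →
  (∀ {a b} → a ∈ₛ A → b ∈ₛ A → ¬ a ≡ b → R a b) → AllPairs R (elems A)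
elems-AllPairs []          h = []
elems-AllPairs (true ∷ p)  h =
  All-map⁺ (elems-All p (λ b∈ → h here (there b∈) λ ()))
  ∷ AllPairs-map⁺ (elems-AllPairs p (λ a∈ b∈ a≢b → h (there a∈) (there b∈) (a≢b ∘ suc-injective)))
elems-AllPairs (false ∷ p) h =
  AllPairs-map⁺ (elems-AllPairs p (λ a∈ b∈ a≢b → h (there a∈) (there b∈) (a≢b ∘ suc-injective)))

elems-∪ : ∀ {m} (A B : Subset m) → (∀ {a} → a ∈ₛ A → a ∈ₛ B → ⊥) →
  elems A ++ elems B ↭ elems (A ∪ B)
elems-∪ []      []      _        = refl
elems-∪ (s ∷ p) (t ∷ q) disjoint = heads s t (λ { refl refl → disjoint here here })
  where
  tails : map suc (elems p) ++ map suc (elems q) ↭ map suc (elems (p ∪ q))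
  tails = trans (↭-reflexive (sym (map-++ suc (elems p) (elems q))))
                (↭-map⁺ suc (elems-∪ p q (λ a∈p a∈q → disjoint (there a∈p) (there a∈q))))
  heads : ∀ s t → (s ≡ true → t ≡ true → ⊥) →
          elems (s ∷ p) ++ elems (t ∷ q) ↭ elems ((s ∷ p) ∪ (t ∷ q))
  heads true  true  ¬both = ⊥-elim (¬both refl refl)
  heads true  false _     = prep zero tails
  heads false true  _     =
    trans (shift zero (map suc (elems p)) (map suc (elems q))) (prep zero tails)
  heads false false _     = tails

-- Indexed by a nonempty list, so that the last set merged is a genuine
-- singleton ⁅ y ⁆ rather than ⁅ y ⁆ ∪ ⊥.
subsetOf : ∀ {m} → Fin m → List (Fin m) → Subset m
subsetOf x []       = ⁅ x ⁆
subsetOf x (y ∷ ys) = ⁅ x ⁆ ∪ subsetOf y ys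

∈-subsetOf⁻ : ∀ {m} (x : Fin m) ys {a} → a ∈ₛ subsetOf x ys → a ∈ₗ x ∷ ys
∈-subsetOf⁻ x []       a∈ = here (x∈⁅y⁆⇒x≡y x a∈)
∈-subsetOf⁻ x (y ∷ ys) a∈ with x∈p∪q⁻ ⁅ x ⁆ (subsetOf y ys) a∈
... | inj₁ a∈⁅x⁆ = here (x∈⁅y⁆⇒x≡y x a∈⁅x⁆)
... | inj₂ a∈ys  = there (∈-subsetOf⁻ y ys a∈ys)

∈-subsetOf⁺ : ∀ {m} (x : Fin m) ys {a} → a ∈ₗ x ∷ ys → a ∈ₛ subsetOf x ys
∈-subsetOf⁺ x []       (here refl) = x∈⁅x⁆ x
∈-subsetOf⁺ x (y ∷ ys) (here refl) = x∈p∪q⁺ (inj₁ (x∈⁅x⁆ x))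
∈-subsetOf⁺ x (y ∷ ys) (there a∈)  = x∈p∪q⁺ (inj₂ (∈-subsetOf⁺ y ys a∈))

subsetOf-↭ : ∀ {m} {A : Subset m} x ys → x ∷ ys ↭ elems A → subsetOf x ys ≡ A
subsetOf-↭ {A = A} x ys p = ⊆-antisym
  (λ a∈ → ∈-elems⁻ A (∈-resp-↭ p (∈-subsetOf⁻ x ys a∈)))
  (λ a∈ → ∈-subsetOf⁺ x ys (∈-resp-↭ (↭-sym p) (∈-elems⁺ A a∈)))

module Sorting {n : ℕ} {_≤_ : Rel (Fin n) 0ℓ} (tot : IsTotalOrder _≡_ _≤_) where
  open IsTotalOrder tot using (total)

  insert-↭ : ∀ x ys → insert tot x ys ↭ x ∷ ys
  insert-↭ x []       = refl
  insert-↭ x (y ∷ ys) with total x y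
  ... | inj₁ _ = refl
  ... | inj₂ _ = trans (prep y (insert-↭ x ys)) (swap y x refl)

  sortList-↭ : ∀ xs → sortList tot xs ↭ xs
  sortList-↭ []       = refl
  sortList-↭ (x ∷ xs) = trans (insert-↭ x (sortList tot xs)) (prep x (sortList-↭ xs))

  lexStep-↭ : ∀ A → lexStep tot A ↭ elems A
  lexStep-↭ A = sortList-↭ (elems A)

  lex-++ : ∀ u v → lex tot (u ++ v) ≡ lex tot u ++ lex tot v
  lex-++ = concatMap-++ (lexStep tot)

module _ (Ψ : ConcurrentAlphabet) where
  open ConcurrentAlphabet Ψ

  Independent : Subset n → Subset n → Set
  Independent A B = ∀ {a b} → a ∈ₛ A → b ∈ₛ B → ind a b

  ⁅⁆-isStep : ∀ x → IsStep Ψ ⁅ x ⁆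
  ⁅⁆-isStep x = (x , x∈⁅x⁆ x) , λ a∈ b∈ a≢b →
    ⊥-elim (a≢b (≡-trans (x∈⁅y⁆⇒x≡y x a∈) (sym (x∈⁅y⁆⇒x≡y x b∈))))

  ∪-isStep : ∀ {A B} → IsStep Ψ A → IsStep Ψ B → Independent A B → IsStep Ψ (A ∪ B)
  ∪-isStep {A} {B} ((a , a∈A) , A-pairwise) (_ , B-pairwise) A×B⊆ind =
    (a , x∈p∪q⁺ (inj₁ a∈A)) , pairwise
    where
    pairwise : ∀ {a b} → a ∈ₛ A ∪ B → b ∈ₛ A ∪ B → ¬ a ≡ b → ind a b
    pairwise a∈ b∈ a≢b with x∈p∪q⁻ A B a∈ | x∈p∪q⁻ A B b∈
    ... | inj₁ a∈A | inj₁ b∈A = A-pairwise a∈A b∈A a≢b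
    ... | inj₁ a∈A | inj₂ b∈B = A×B⊆ind a∈A b∈B
    ... | inj₂ a∈B | inj₁ b∈A = ind-sym (A×B⊆ind b∈A a∈B)
    ... | inj₂ a∈B | inj₂ b∈B = B-pairwise a∈B b∈B a≢b

  ⁅⁆-subsetOf-independent : ∀ {x} y ys → All (ind x) (y ∷ ys) → Independent ⁅ x ⁆ (subsetOf y ys)
  ⁅⁆-subsetOf-independent {x} y ys x⊥ys a∈⁅x⁆ b∈
    rewrite x∈⁅y⁆⇒x≡y x a∈⁅x⁆ = All.lookup x⊥ys (∈-subsetOf⁻ y ys b∈)

  subsetOf-isStep : ∀ x ys → AllPairs ind (x ∷ ys) → IsStep Ψ (subsetOf x ys)
  subsetOf-isStep x []       _                = ⁅⁆-isStep x
  subsetOf-isStep x (y ∷ ys) (x⊥ys ∷ ys-indep) =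
    ∪-isStep (⁅⁆-isStep x) (subsetOf-isStep y ys ys-indep) (⁅⁆-subsetOf-independent y ys x⊥ys)

  ≡Σ-++⁺ˡ : ∀ p {x y} → _≡Σ_ Ψ x y → _≡Σ_ Ψ (p ++ x) (p ++ y)
  ≡Σ-++⁺ˡ p = gmap (p ++_) λ where
    (swap u a b z a⊥b) →
      subst₂ (SwapStep Ψ) (++-assoc p u _) (++-assoc p u _) (swap (p ++ u) a b z a⊥b)

  ≡Σ-++⁺ʳ : ∀ q {x y} → _≡Σ_ Ψ x y → _≡Σ_ Ψ (x ++ q) (y ++ q)
  ≡Σ-++⁺ʳ q = gmap (_++ q) λ where
    (swap u a b z a⊥b) →
      subst₂ (SwapStep Ψ) (sym (++-assoc u _ q)) (sym (++-assoc u _ q)) (swap u a b (z ++ q) a⊥b)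

  ≡Σ-sym : ∀ {x y} → _≡Σ_ Ψ x y → _≡Σ_ Ψ y x
  ≡Σ-sym = Star.reverse λ where
    (swap u a b z a⊥b) → swap u b a z (ind-sym a⊥b)

  ↭⇒≡Σ : ∀ {xs ys} → xs ↭ ys → AllPairs ind xs → _≡Σ_ Ψ xs ys
  ↭⇒≡Σ refl         _                            = ε
  ↭⇒≡Σ (prep x p)   (_ ∷ xs-indep)               = ≡Σ-++⁺ˡ (x ∷ []) (↭⇒≡Σ p xs-indep)
  ↭⇒≡Σ (swap x y p) ((x⊥y ∷ _) ∷ _ ∷ xs-indep) =
    ≡Σ-++⁺ˡ (x ∷ y ∷ []) (↭⇒≡Σ p xs-indep) ◅◅ swap [] x y _ x⊥y ◅ ε
  ↭⇒≡Σ (trans p q)  xs-indep =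
    ↭⇒≡Σ p xs-indep ◅◅ ↭⇒≡Σ q (AllPairs-resp-↭ ind-sym p xs-indep)

  ≡S-++⁺ˡ : ∀ p {x y} → _≡S_ Ψ x y → _≡S_ Ψ (p ++ x) (p ++ y)
  ≡S-++⁺ˡ p = gmap (p ++_) (SymClosure.gmap (p ++_) λ where
    (merge u A B z sA sB A×B⊆ind) →
      subst₂ (MergeStep Ψ) (++-assoc p u _) (++-assoc p u _) (merge (p ++ u) A B z sA sB A×B⊆ind))

  ≡S-++⁺ʳ : ∀ q {x y} → _≡S_ Ψ x y → _≡S_ Ψ (x ++ q) (y ++ q)
  ≡S-++⁺ʳ q = gmap (_++ q) (SymClosure.gmap (_++ q) λ where
    (merge u A B z sA sB A×B⊆ind) →
      subst₂ (MergeStep Ψ) (sym (++-assoc u _ q)) (sym (++-assoc u _ q))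
        (merge u A B (z ++ q) sA sB A×B⊆ind))

  ≡S-sym : ∀ {x y} → _≡S_ Ψ x y → _≡S_ Ψ y x
  ≡S-sym = Star.reverse (SymClosure.symmetric (MergeStep Ψ))

  singletons : List (Fin n) → List (Subset n)
  singletons = map ⁅_⁆

  singletons-merge : ∀ x ys → AllPairs ind (x ∷ ys) →
                     _≡S_ Ψ (singletons (x ∷ ys)) (subsetOf x ys ∷ [])
  singletons-merge x []       _                = ε
  singletons-merge x (y ∷ ys) (x⊥ys ∷ ys-indep) =
    ≡S-++⁺ˡ (⁅ x ⁆ ∷ []) (singletons-merge y ys ys-indep)
    ◅◅ fwd (merge [] ⁅ x ⁆ (subsetOf y ys) [] (⁅⁆-isStep x) (subsetOf-isStep y ys ys-indep)
                  (⁅⁆-subsetOf-independent y ys x⊥ys))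
    ◅ ε

  singletons-swap : ∀ {a b} z → ind a b → _≡S_ Ψ (⁅ a ⁆ ∷ ⁅ b ⁆ ∷ z) (⁅ b ⁆ ∷ ⁅ a ⁆ ∷ z)
  singletons-swap {a} {b} z a⊥b =
    fwd (merge [] ⁅ a ⁆ ⁅ b ⁆ z (⁅⁆-isStep a) (⁅⁆-isStep b)
               (⁅⁆-subsetOf-independent b [] (a⊥b ∷ [])))
    ◅ subst (λ C → SymClosure (MergeStep Ψ) (C ∷ z) (⁅ b ⁆ ∷ ⁅ a ⁆ ∷ z)) (∪-comm ⁅ b ⁆ ⁅ a ⁆)
        (bwd (merge [] ⁅ b ⁆ ⁅ a ⁆ z (⁅⁆-isStep b) (⁅⁆-isStep a)
                    (⁅⁆-subsetOf-independent a [] (ind-sym a⊥b ∷ []))))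
    ◅ ε

  ≡Σ⇒≡S-singletons : ∀ {x y} → _≡Σ_ Ψ x y → _≡S_ Ψ (singletons x) (singletons y)
  ≡Σ⇒≡S-singletons = kleisliStar singletons λ where
    (swap u a b z a⊥b) → subst₂ (_≡S_ Ψ) (sym (map-++ ⁅_⁆ u _)) (sym (map-++ ⁅_⁆ u _))
                           (≡S-++⁺ˡ (singletons u) (singletons-swap (singletons z) a⊥b))

  module _ {_≤_ : Rel (Fin n) 0ℓ} (tot : IsTotalOrder _≡_ _≤_) where
    open Sorting tot

    lexStep-AllPairs : ∀ {A} → IsStep Ψ A → AllPairs ind (lexStep tot A)
    lexStep-AllPairs {A} (_ , pairwise) =
      AllPairs-resp-↭ ind-sym (↭-sym (lexStep-↭ A)) (elems-AllPairs A pairwise)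

    lexStep-∪ : ∀ {A B} → IsStep Ψ A → IsStep Ψ B → Independent A B →
                _≡Σ_ Ψ (lexStep tot A ++ lexStep tot B) (lexStep tot (A ∪ B))
    lexStep-∪ {A} {B} sA sB A×B⊆ind =
      ↭⇒≡Σ lexA++lexB↭lexA∪B
        (AllPairs-resp-↭ ind-sym (↭-sym lexA++lexB↭lexA∪B)
          (lexStep-AllPairs (∪-isStep sA sB A×B⊆ind)))
      where
      open PermutationReasoning
      lexA++lexB↭lexA∪B : lexStep tot A ++ lexStep tot B ↭ lexStep tot (A ∪ B)
      lexA++lexB↭lexA∪B = begin
        lexStep tot A ++ lexStep tot B  ↭⟨ ++⁺ (lexStep-↭ A) (lexStep-↭ B) ⟩
        elems A ++ elems B              ↭⟨ elems-∪ A B disjoint ⟩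
        elems (A ∪ B)                   ↭⟨ lexStep-↭ (A ∪ B) ⟨
        lexStep tot (A ∪ B)             ∎
        where
        disjoint : ∀ {a} → a ∈ₛ A → a ∈ₛ B → ⊥
        disjoint a∈A a∈B = ind-irr refl (A×B⊆ind a∈A a∈B)

    mergeStep-lex : ∀ {x y} → MergeStep Ψ x y → _≡Σ_ Ψ (lex tot x) (lex tot y)
    mergeStep-lex (merge u A B z sA sB A×B⊆ind) =
      subst₂ (_≡Σ_ Ψ) (sym (lex-++ u (A ∷ B ∷ z))) (sym (lex-++ u ((A ∪ B) ∷ z)))
        (≡Σ-++⁺ˡ (lex tot u)
          (subst₂ (_≡Σ_ Ψ) (++-assoc (lexStep tot A) (lexStep tot B) (lex tot z)) refl
            (≡Σ-++⁺ʳ (lex tot z) (lexStep-∪ sA sB A×B⊆ind))))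

    ≡S⇒lex-≡Σ : ∀ {w u} → _≡S_ Ψ w u → _≡Σ_ Ψ (lex tot w) (lex tot u)
    ≡S⇒lex-≡Σ =
      kleisliStar (lex tot) (SymClosure.gfold {S = _≡Σ_ Ψ} ≡Σ-sym (lex tot) mergeStep-lex)

    step-≡S-singletons : ∀ {A} → IsStep Ψ A → _≡S_ Ψ (A ∷ []) (singletons (lexStep tot A))
    step-≡S-singletons {A} sA with lexStep tot A | lexStep-↭ A | lexStep-AllPairs sA
    step-≡S-singletons {A} ((a , a∈A) , _) | [] | lex↭ | _
      with ∈-resp-↭ (↭-sym lex↭) (∈-elems⁺ A a∈A)
    ... | ()
    step-≡S-singletons {A} _ | x ∷ ys | lex↭ | indep =
      subst (λ C → _≡S_ Ψ (C ∷ []) (singletons (x ∷ ys))) (subsetOf-↭ x ys lex↭)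
        (≡S-sym (singletons-merge x ys indep))

    stepSeq-≡S-singletons : ∀ {w} → IsStepSeq Ψ w → _≡S_ Ψ w (singletons (lex tot w))
    stepSeq-≡S-singletons []                  = ε
    stepSeq-≡S-singletons {A ∷ w} (sA ∷ sw) =
      subst (_≡S_ Ψ (A ∷ w)) (sym (map-++ ⁅_⁆ (lexStep tot A) (lex tot w)))
        (≡S-++⁺ʳ w (step-≡S-singletons sA)
         ◅◅ ≡S-++⁺ˡ (singletons (lexStep tot A)) (stepSeq-≡S-singletons sw))

proposition2p4 : (Ψ : ConcurrentAlphabet) →
    (_≤_ : Rel (Fin (ConcurrentAlphabet.n Ψ)) 0ℓ) →
    (tot : IsTotalOrder _≡_ _≤_) →
    (w u : List (Subset (ConcurrentAlphabet.n Ψ))) →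
    IsStepSeq Ψ w → IsStepSeq Ψ u →
    ((_≡S_ Ψ w u → _≡Σ_ Ψ (lex tot w) (lex tot u)) ×
     (_≡Σ_ Ψ (lex tot w) (lex tot u) → _≡S_ Ψ w u))
proposition2p4 Ψ _≤_ tot w u w-steps u-steps =
  ≡S⇒lex-≡Σ Ψ tot ,
  λ lex-equiv → stepSeq-≡S-singletons Ψ tot w-steps
                ◅◅ ≡Σ⇒≡S-singletons Ψ lex-equiv
                ◅◅ ≡S-sym Ψ (stepSeq-≡S-singletons Ψ tot u-steps)
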